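{- The binary operation $\triangleright$ on $\mathbf{k}[[x_1,x_2,x_3,\ldots]]$ is associative. It is also unital, with $1$ serving as the unity.
   Context: Let $\mathbf{k}$ be a commutative ring and $\mathbf{k}[[x_1,x_2,\ldots]]$ the ring of formal power series in commuting indeterminates, with the product topology (a sequence converges iff each monomial coefficient eventually stabilizes). A monomial is $x_1^{a_1}x_2^{a_2}\cdots$ with finitely many nonzero exponents; $\mathrm{Supp}\,\mathfrak m=\{i:a_i>0\}$; conventions $\min\varnothing=\infty$ (greater than every integer), $\max\varnothing=0$. $\triangleright$ is the unique $\mathbf{k}$-bilinear binary operation on $\mathbf{k}[[x_1,x_2,\ldots]]$, continuous with respect to this topology, with $\mathfrak m\triangleright\mathfrak n=\mathfrak m\mathfrak n$ if $\max(\mathrm{Supp}\,\mathfrak m)\le\min(\mathrm{Supp}\,\mathfrak n)$ and $\mathfrak m\triangleright\mathfrak n=0$ otherwise, for all monomials $\mathfrak m,\mathfrak n$. -}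

module Defs where

open import Level using (Level)
open import Algebra.Bundles using (CommutativeRing)
open import Data.Nat using (ℕ; zero; suc; _≤_; _≤?_; _⊔_; _≡ᵇ_; _∸_)
open import Data.Nat.Properties using (≤-totalOrder)
open import Data.Bool using (Bool; true; false; if_then_else_)
open import Data.Maybe using (Maybe; just; nothing)
open import Data.Product using (_×_; _,_)
open import Data.List using (List; []; _∷_; [_]; _++_; map; concatMap; replicate; upTo; length; foldr)
open import Relation.Nullary using (does)
import Data.List.Relation.Unary.Sorted.TotalOrder as SortedTO

-- Variables x₁, x₂, x₃, … ; the natural number i encodes the variable x_{i+1}.
-- A monomial is encoded as the weakly increasing list of the indices of its
-- variables, each repeated according to its exponent (canonical multiset form);
-- e.g. x₁² x₃ is [0 , 0 , 2].
Monomial : Set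
Monomial = List ℕ

IsMonomial : Monomial → Set
IsMonomial = SortedTO.Sorted ≤-totalOrder

-- max (Supp 𝔪) with max ∅ = 0 (as a variable number, i ↦ i+1)
maxSupp : Monomial → ℕ
maxSupp = foldr (λ i r → suc i ⊔ r) 0

-- min (Supp 𝔫) with min ∅ = ∞ (nothing = ∞)
minSupp : Monomial → Maybe ℕ
minSupp [] = nothing
minSupp (i ∷ is) with minSupp is
... | nothing = just (suc i)
... | just r  = just (if does (suc i ≤? r) then suc i else r)

suppOK : Monomial → Monomial → Bool
suppOK m n with minSupp n
... | nothing = true
... | just r  = does (maxSupp m ≤? r)

takeRun : ℕ → List ℕ → ℕ × List ℕ
takeRun x [] = 0 , []
takeRun x (y ∷ ys) with x ≡ᵇ y
... | true  with takeRun x ys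
...            | a , rest = suc a , rest
takeRun x (y ∷ ys) | false = 0 , y ∷ ys

-- all ordered pairs (𝔭 , 𝔮) of monomials with 𝔭 𝔮 = 𝔪, each exactly once
-- (for a sorted 𝔪): for each run xᵢ^a of 𝔪 choose the exponent b ∈ {0,…,a}
-- of xᵢ in 𝔭, the rest a ∸ b going to 𝔮.  The first argument is fuel.
facs : ℕ → Monomial → List (Monomial × Monomial)
facs _ [] = [ ([] , []) ]
facs zero (_ ∷ _) = []
facs (suc n) (x ∷ xs) with takeRun x xs
... | a , rest =
  concatMap (λ b → map (λ { (p , q) → (replicate b x ++ p , replicate (suc a ∸ b) x ++ q) })
                       (facs n rest))
            (upTo (suc (suc a)))

factorizations : Monomial → List (Monomial × Monomial)
factorizations m = facs (length m) m

module PowerSeries {c ℓ : Level} (R : CommutativeRing c ℓ) where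
  open CommutativeRing R

  Series : Set c
  Series = Monomial → Carrier

  _≈ₛ_ : Series → Series → Set ℓ
  f ≈ₛ g = ∀ m → IsMonomial m → f m ≈ g m

  one : Series
  one []      = 1#
  one (_ ∷ _) = 0#

  -- 𝔭 ▷ 𝔮 = 𝔭𝔮 if max Supp 𝔭 ≤ min Supp 𝔮, and 0 otherwise; hence the
  -- continuous bilinear extension has coefficient
  --   (f ▷ g)_𝔪 = Σ_{𝔭 𝔮 = 𝔪} f_𝔭 g_𝔮 [max Supp 𝔭 ≤ min Supp 𝔮]
  _▷_ : Series → Series → Series
  (f ▷ g) m = foldr _+_ 0#
    (map (λ { (p , q) → if suppOK p q then f p * g q else 0# }) (factorizations m))

-- On a sorted monomial m (a weakly increasing word in the variable indices), a factorization
-- m = p q satisfies max Supp p ≤ min Supp q exactly when p is a prefix of m and q the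
-- complementary suffix.  So (f ▷ g)_m = Σ f_u g_v over the 1 + length m ways of cutting m as
-- m = u v: on coefficients, ▷ is the deconcatenation (Cauchy) product of words.  That product is
-- associative with unit 1, since both bracketings sum over the ways of cutting m into three
-- pieces, and prefixes and suffixes of sorted words are again sorted.

module Submission where

open import Defs
open import Level using (Level)
open import Algebra.Bundles using (Monoid; Semiring; CommutativeRing)
open import Data.Bool using (true; false; T; if_then_else_)
open import Data.Empty using (⊥-elim)
open import Data.List using (List; []; _∷_; [_]; _++_; _∷ʳ_; map; concatMap; replicate; upTo; length; foldr; null; take; drop)
open import Data.List.Properties using (++-identityʳ; upTo-∷ʳ; map-upTo; map-∘; length-++-≤ʳ)
open import Data.List.Relation.Unary.All as All using (All; []; _∷_)
open import Data.List.Relation.Unary.All.Properties using (++⁺; ++⁻ʳ; replicate⁺; concat⁺; map⁺; All-swap; applyUpTo⁺₁)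
open import Data.List.Relation.Unary.AllPairs using (AllPairs; _∷_)
import Data.List.Relation.Unary.AllPairs.Properties as AllPairs
open import Data.List.Relation.Unary.Sorted.TotalOrder.Properties using (Sorted⇒AllPairs)
open import Data.Maybe using (just; nothing)
open import Data.Maybe.Relation.Unary.All as Maybe using (just; nothing)
open import Data.Nat using (ℕ; zero; suc; _≤_; _<_; _∸_; _<ᵇ_; _≡ᵇ_; z≤n; s≤s)
open import Data.Nat.Properties using (≤-refl; ≤-trans; ≤-pred; <⇒≤; <⇒≱; <-≤-trans; ≰⇒>; ≤∧≢⇒<; ≡ᵇ⇒≡; ≡⇒≡ᵇ; <ᵇ-reflects-<; ≤ᵇ⇒≤; ≤⇒≤ᵇ; ⊔-lub; m≤m⊔n; m≤n⊔m; n∸n≡0; +-∸-assoc; ≤-totalOrder)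
open import Data.Product using (_×_; _,_; proj₁; proj₂)
open import Data.Unit using (tt)
open import Function.Base using (id; _∘_)
open import Function.Bundles using (_⇔_; mk⇔; Equivalence)
open import Relation.Nullary using (¬_)
open import Relation.Nullary.Reflects using (ofʸ; ofⁿ; fromEquivalence; det)
open import Relation.Binary.PropositionalEquality as ≡ using (_≡_)

Precedes : Monomial → Monomial → Set
Precedes p q = All (λ i → All (i ≤_) q) p

maxSupp≤⇔ : ∀ {k} p → maxSupp p ≤ k ⇔ All (_< k) p
maxSupp≤⇔ {k} p = mk⇔ (to p) (from p)
  where
  to : ∀ p → maxSupp p ≤ k → All (_< k) p
  to []      _  = []
  to (i ∷ p) le =
    ≤-trans (m≤m⊔n (suc i) (maxSupp p)) le ∷ to p (≤-trans (m≤n⊔m (suc i) (maxSupp p)) le)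
  from : ∀ p → All (_< k) p → maxSupp p ≤ k
  from []      []          = z≤n
  from (i ∷ p) (i<k ∷ p<k) = ⊔-lub i<k (from p p<k)

≤minSupp⇔ : ∀ {k} q → Maybe.All (k ≤_) (minSupp q) ⇔ All (λ j → k ≤ suc j) q
≤minSupp⇔ {k} q = mk⇔ (to q) (from q)
  where
  to : ∀ q → Maybe.All (k ≤_) (minSupp q) → All (λ j → k ≤ suc j) q
  to []      _ = []
  to (i ∷ q) with minSupp q | to q
  ... | nothing | ih = λ { (just k≤i) → k≤i ∷ ih nothing }
  ... | just r  | ih with i <ᵇ r | <ᵇ-reflects-< i r
  ...   | true  | ofʸ i<r = λ { (just k≤i) → k≤i ∷ ih (just (≤-trans k≤i i<r)) }
  ...   | false | ofⁿ i≮r = λ { (just k≤r) → ≤-trans k≤r (<⇒≤ (≰⇒> i≮r)) ∷ ih (just k≤r) }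
  from : ∀ q → All (λ j → k ≤ suc j) q → Maybe.All (k ≤_) (minSupp q)
  from []      [] = nothing
  from (i ∷ q) (k≤i ∷ k≤q) with minSupp q | from q k≤q
  ... | nothing | _        = just k≤i
  ... | just r  | just k≤r with i <ᵇ r
  ...   | true  = just k≤i
  ...   | false = just k≤r

T-suppOK⇔maxSupp≤minSupp : ∀ p q → T (suppOK p q) ⇔ Maybe.All (maxSupp p ≤_) (minSupp q)
T-suppOK⇔maxSupp≤minSupp p q with minSupp q
... | nothing = mk⇔ (λ _ → nothing) (λ _ → tt)
... | just r  = mk⇔ (λ t → just (≤ᵇ⇒≤ (maxSupp p) r t)) (λ { (just le) → ≤⇒≤ᵇ le })

T-suppOK⇔Precedes : ∀ p q → T (suppOK p q) ⇔ Precedes p q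
T-suppOK⇔Precedes p q = mk⇔ sound complete
  where
  open Equivalence
  sound : T (suppOK p q) → Precedes p q
  sound t = All-swap (All.map (λ le → All.map ≤-pred (to (maxSupp≤⇔ p) le))
                              (to (≤minSupp⇔ q) (to (T-suppOK⇔maxSupp≤minSupp p q) t)))
  complete : Precedes p q → T (suppOK p q)
  complete pq = from (T-suppOK⇔maxSupp≤minSupp p q)
    (from (≤minSupp⇔ q) (All.map (λ p≤j → from (maxSupp≤⇔ p) (All.map s≤s p≤j)) (All-swap pq)))

suppOK-++ˡ : ∀ l p q → Precedes l q → suppOK (l ++ p) q ≡ suppOK p q
suppOK-++ˡ l p q lq =
  det (fromEquivalence (to (T-suppOK⇔Precedes (l ++ p) q)) (from (T-suppOK⇔Precedes (l ++ p) q)))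
      (fromEquivalence (λ t → ++⁺ lq (to (T-suppOK⇔Precedes p q) t))
                       (λ lpq → from (T-suppOK⇔Precedes p q) (++⁻ʳ l lpq)))
  where open Equivalence

takeRun-++ : ∀ x xs → xs ≡ replicate (proj₁ (takeRun x xs)) x ++ proj₂ (takeRun x xs)
takeRun-++ x []       = ≡.refl
takeRun-++ x (y ∷ ys) with x ≡ᵇ y | ≡ᵇ⇒≡ x y
... | false | _   = ≡.refl
... | true  | x≡y = ≡.cong₂ _∷_ (≡.sym (x≡y tt)) (takeRun-++ x ys)

takeRun-rest> : ∀ {x} xs → All (x ≤_) xs → AllPairs _≤_ xs → All (x <_) (proj₂ (takeRun x xs))
takeRun-rest> []       _            _            = []
takeRun-rest> {x} (y ∷ ys) (x≤y ∷ x≤ys) (y≤ys ∷ ys↗) with x ≡ᵇ y | ≡⇒≡ᵇ x y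
... | true  | _   = takeRun-rest> ys x≤ys ys↗
... | false | x≢y = x<y ∷ All.map (<-≤-trans x<y) y≤ys
  where
  x<y : x < y
  x<y = ≤∧≢⇒< x≤y x≢y

AllPairs-++⁻ʳ : ∀ {A : Set} {R : A → A → Set} xs {ys} → AllPairs R (xs ++ ys) → AllPairs R ys
AllPairs-++⁻ʳ []       xs↗       = xs↗
AllPairs-++⁻ʳ (_ ∷ xs) (_ ∷ xs↗) = AllPairs-++⁻ʳ xs xs↗

All-facs : ∀ {P : ℕ → Set} n m → All P m → All (λ e → All P (proj₁ e) × All P (proj₂ e)) (facs n m)
All-facs _       []       _          = ([] , []) ∷ []
All-facs zero    (_ ∷ _)  _          = []
All-facs (suc n) (x ∷ xs) (px ∷ pxs) with takeRun x xs | takeRun-++ x xs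
... | a , rest | ≡.refl = concat⁺ (map⁺ (All.universal (λ b → map⁺ (All.map
      (λ (pp , pq) → ++⁺ (replicate⁺ b px) pp , ++⁺ (replicate⁺ (suc a ∸ b) px) pq)
      (All-facs n rest (++⁻ʳ (replicate a x) pxs)))) (upTo (suc (suc a)))))

module Sums {c ℓ : Level} (M : Monoid c ℓ) where
  open Monoid M
  open import Relation.Binary.Reasoning.Setoid setoid

  ∑ : {A : Set} → List A → (A → Carrier) → Carrier
  ∑ xs f = foldr _∙_ ε (map f xs)

  ∑-++ : ∀ {A : Set} (xs ys : List A) f → ∑ (xs ++ ys) f ≈ ∑ xs f ∙ ∑ ys f
  ∑-++ []       ys f = sym (identityˡ _)
  ∑-++ (x ∷ xs) ys f = trans (∙-congˡ (∑-++ xs ys f)) (sym (assoc _ _ _))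

  ∑-map : ∀ {A B : Set} (g : A → B) xs f → ∑ (map g xs) f ≡ ∑ xs (f ∘ g)
  ∑-map g xs f = ≡.cong (foldr _∙_ ε) (≡.sym (map-∘ xs))

  ∑-concatMap-map : ∀ {A B C : Set} (g : A → B → C) (h : A → List B) xs f →
                    ∑ (concatMap (λ a → map (g a) (h a)) xs) f ≈ ∑ xs (λ a → ∑ (h a) (f ∘ g a))
  ∑-concatMap-map g h []       f = refl
  ∑-concatMap-map g h (x ∷ xs) f =
    trans (∑-++ (map (g x) (h x)) _ f)
          (∙-cong (reflexive (∑-map (g x) (h x) f)) (∑-concatMap-map g h xs f))

  ∑-congᴬ : ∀ {A : Set} {f g : A → Carrier} {xs} → All (λ a → f a ≈ g a) xs → ∑ xs f ≈ ∑ xs g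
  ∑-congᴬ []            = refl
  ∑-congᴬ (fx≈gx ∷ f≈g) = ∙-cong fx≈gx (∑-congᴬ f≈g)

  ∑-zero : ∀ {A : Set} xs {f : A → Carrier} → (∀ a → f a ≈ ε) → ∑ xs f ≈ ε
  ∑-zero []       f≈ε = refl
  ∑-zero (x ∷ xs) f≈ε = trans (∙-cong (f≈ε x) (∑-zero xs f≈ε)) (identityˡ ε)

  ∑-cong-upTo : ∀ n {f g : ℕ → Carrier} → (∀ {i} → i < n → f i ≈ g i) → ∑ (upTo n) f ≈ ∑ (upTo n) g
  ∑-cong-upTo n f≈g = ∑-congᴬ (applyUpTo⁺₁ id n f≈g)

  ∑-upTo-sucˡ : ∀ n f → ∑ (upTo (suc n)) f ≡ f 0 ∙ ∑ (upTo n) (f ∘ suc)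
  ∑-upTo-sucˡ n f =
    ≡.cong (f 0 ∙_) (≡.trans (≡.cong (λ l → ∑ l f) (≡.sym (map-upTo suc n))) (∑-map suc (upTo n) f))

  ∑-upTo-sucʳ : ∀ n f → ∑ (upTo (suc n)) f ≈ ∑ (upTo n) f ∙ f n
  ∑-upTo-sucʳ n f = begin
    ∑ (upTo (suc n)) f        ≡⟨ ≡.cong (λ l → ∑ l f) (≡.sym (upTo-∷ʳ n)) ⟩
    ∑ (upTo n ∷ʳ n) f         ≈⟨ ∑-++ (upTo n) [ n ] f ⟩
    ∑ (upTo n) f ∙ (f n ∙ ε)  ≈⟨ ∙-congˡ (identityʳ _) ⟩
    ∑ (upTo n) f ∙ f n        ∎

  -- sumSplits F m = Σₖ F (take k m) (drop k m), over the cuts 0 ≤ k ≤ length m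
  sumSplits : {A : Set} → (List A → List A → Carrier) → List A → Carrier
  sumSplits F []       = F [] []
  sumSplits F (x ∷ xs) = F [] (x ∷ xs) ∙ sumSplits (λ u → F (x ∷ u)) xs

  sumSplits-cong : ∀ {A : Set} {F G : List A → List A → Carrier} m →
                   (∀ k → F (take k m) (drop k m) ≈ G (take k m) (drop k m)) →
                   sumSplits F m ≈ sumSplits G m
  sumSplits-cong []       F≈G = F≈G 0
  sumSplits-cong (x ∷ xs) F≈G = ∙-cong (F≈G 0) (sumSplits-cong xs (F≈G ∘ suc))

  sumSplits-zero : ∀ {A : Set} {F : List A → List A → Carrier} m →
                   (∀ u v → F u v ≈ ε) → sumSplits F m ≈ ε
  sumSplits-zero []       F≈ε = F≈ε [] []
  sumSplits-zero (x ∷ xs) F≈ε =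
    trans (∙-cong (F≈ε _ _) (sumSplits-zero xs (F≈ε ∘ (x ∷_)))) (identityˡ ε)

  sumSplits-replicate-++ : ∀ {A : Set} F (x : A) c rest →
    sumSplits F (replicate c x ++ rest)
      ≈ ∑ (upTo c) (λ b → F (replicate b x) (replicate (c ∸ b) x ++ rest))
        ∙ sumSplits (λ u → F (replicate c x ++ u)) rest
  sumSplits-replicate-++ F x zero    rest = sym (identityˡ _)
  sumSplits-replicate-++ F x (suc c) rest =
    trans (∙-congˡ (sumSplits-replicate-++ (λ u → F (x ∷ u)) x c rest))
    (trans (sym (assoc _ _ _))
           (∙-congʳ (reflexive (≡.sym (∑-upTo-sucˡ c
             (λ b → F (replicate b x) (replicate (suc c ∸ b) x ++ rest)))))))

module Factorizations {c ℓ : Level} (M : Monoid c ℓ) where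
  open Monoid M
  open Sums M
  open import Relation.Binary.Reasoning.Setoid setoid

  onSuppOK : (Monomial → Monomial → Carrier) → Monomial × Monomial → Carrier
  onSuppOK F (p , q) = if suppOK p q then F p q else ε

  onSuppOK-yes : ∀ F {p q} → Precedes p q → onSuppOK F (p , q) ≡ F p q
  onSuppOK-yes F {p} {q} pq with suppOK p q | Equivalence.from (T-suppOK⇔Precedes p q) pq
  ... | true  | _  = ≡.refl
  ... | false | ()

  onSuppOK-no : ∀ F {p q} → ¬ Precedes p q → onSuppOK F (p , q) ≡ ε
  onSuppOK-no F {p} {q} ¬pq with suppOK p q | Equivalence.to (T-suppOK⇔Precedes p q)
  ... | true  | sound = ⊥-elim (¬pq (sound tt))
  ... | false | _     = ≡.refl

  onSuppOK-++ˡ : ∀ F l {p q} → Precedes l q →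
                 onSuppOK F (l ++ p , q) ≡ onSuppOK (λ u → F (l ++ u)) (p , q)
  onSuppOK-++ˡ F l {p} {q} lq = ≡.cong (λ b → if b then F (l ++ p) q else ε) (suppOK-++ˡ l p q lq)

  onSuppOK-run : ∀ F {x} b c {p q} → All (x <_) p → All (x <_) q →
                 onSuppOK F (replicate b x ++ p , replicate (suc c) x ++ q)
                   ≡ (if null p then F (replicate b x) (replicate (suc c) x ++ q) else ε)
  onSuppOK-run F {x} b c {[]} {q} _ x<q =
    ≡.trans (onSuppOK-yes F (++⁺ (replicate⁺ b x≤xs) [])) (≡.cong (λ l → F l _) (++-identityʳ _))
    where
    x≤xs : All (x ≤_) (replicate (suc c) x ++ q)
    x≤xs = ≤-refl ∷ ++⁺ (replicate⁺ c ≤-refl) (All.map <⇒≤ x<q)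
  onSuppOK-run F {x} b c {y ∷ p} (x<y ∷ _) _ =
    onSuppOK-no F (λ prec → <⇒≱ x<y (All.head (All.head (++⁻ʳ (replicate b x) prec))))

  ∑-facs-null : ∀ (H : Monomial → Carrier) n m → length m ≤ n →
                ∑ (facs n m) (λ (p , q) → if null p then H q else ε) ≈ H m
  ∑-facs-null H _       []       _       = identityʳ _
  ∑-facs-null H (suc n) (x ∷ xs) (s≤s len) with takeRun x xs | takeRun-++ x xs
  ... | a , rest | ≡.refl =
    trans (∑-concatMap-map _ (λ _ → facs n rest) (upTo (suc (suc a))) _)
    (trans (reflexive (∑-upTo-sucˡ (suc a) _))
    (trans (∙-cong (∑-facs-null (λ q → H (x ∷ replicate a x ++ q)) n rest
                                (≤-trans (length-++-≤ʳ rest {replicate a x}) len))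
                   (∑-zero (upTo (suc a)) (λ b → ∑-zero (facs n rest) (λ _ → refl))))
           (identityʳ _)))

  -- Write m = x^(1+a) rest with x < rest.  An admissible (p , q) either gives p the whole run
  -- x^(1+a) (and is then admissible for rest), or gives p only x^b with b ≤ a and nothing of rest.
  ∑-facs-onSuppOK : ∀ F n m → AllPairs _≤_ m → length m ≤ n →
                    ∑ (facs n m) (onSuppOK F) ≈ sumSplits F m
  ∑-facs-onSuppOK F _       []       _            _         = identityʳ _
  ∑-facs-onSuppOK F (suc n) (x ∷ xs) (x≤xs ∷ xs↗) (s≤s len)
    with takeRun x xs | takeRun-++ x xs | takeRun-rest> xs x≤xs xs↗
  ... | a , rest | ≡.refl | x<rest = begin
    _ ≈⟨ ∑-concatMap-map _ (λ _ → facs n rest) (upTo (suc (suc a))) (onSuppOK F) ⟩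
    ∑ (upTo (suc (suc a))) term
      ≈⟨ ∑-upTo-sucʳ (suc a) term ⟩
    ∑ (upTo (suc a)) term ∙ term (suc a)
      ≈⟨ ∙-cong (∑-cong-upTo (suc a) lower) upper ⟩
    ∑ (upTo (suc a)) (λ b → F (replicate b x) (replicate (suc a ∸ b) x ++ rest))
      ∙ sumSplits (λ u → F (replicate (suc a) x ++ u)) rest
      ≈⟨ sumSplits-replicate-++ F x (suc a) rest ⟨
    sumSplits F (x ∷ replicate a x ++ rest) ∎
    where
    len′ : length rest ≤ n
    len′ = ≤-trans (length-++-≤ʳ rest {replicate a x}) len
    term : ℕ → Carrier
    term b = ∑ (facs n rest)
                 (λ (p , q) → onSuppOK F (replicate b x ++ p , replicate (suc a ∸ b) x ++ q))
    lower : ∀ {b} → b < suc a → term b ≈ F (replicate b x) (replicate (suc a ∸ b) x ++ rest)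
    lower {b} (s≤s b≤a) rewrite +-∸-assoc 1 b≤a =
      trans (∑-congᴬ (All.map (λ (x<p , x<q) → reflexive (onSuppOK-run F b (a ∸ b) x<p x<q))
                              (All-facs n rest x<rest)))
            (∑-facs-null (λ q → F (replicate b x) (replicate (suc (a ∸ b)) x ++ q)) n rest len′)
    upper : term (suc a) ≈ sumSplits (λ u → F (replicate (suc a) x ++ u)) rest
    upper rewrite n∸n≡0 a =
      trans (∑-congᴬ (All.map (λ (_ , x<q) → reflexive (onSuppOK-++ˡ F (replicate (suc a) x)
                                                  (replicate⁺ (suc a) (All.map <⇒≤ x<q))))
                              (All-facs n rest x<rest)))
            (∑-facs-onSuppOK (λ u → F (replicate (suc a) x ++ u)) n rest
                             (AllPairs-++⁻ʳ (replicate a x) xs↗) len′)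

module Convolution {c ℓ : Level} (S : Semiring c ℓ) where
  open Semiring S
  open Sums +-monoid using (sumSplits; sumSplits-cong)
  open import Algebra.Properties.CommutativeSemigroup +-commutativeSemigroup using (interchange)
  open import Relation.Binary.Reasoning.Setoid setoid

  _⊛_ : {A : Set} → (List A → Carrier) → (List A → Carrier) → List A → Carrier
  f ⊛ g = sumSplits (λ u v → f u * g v)

  sumSplits-cong′ : ∀ {A : Set} {F G : List A → List A → Carrier} m → (∀ u v → F u v ≈ G u v) →
                    sumSplits F m ≈ sumSplits G m
  sumSplits-cong′ m F≈G = sumSplits-cong m (λ _ → F≈G _ _)

  sumSplits-+ : ∀ {A : Set} (F G : List A → List A → Carrier) m →
                sumSplits (λ u v → F u v + G u v) m ≈ sumSplits F m + sumSplits G m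
  sumSplits-+ F G []       = refl
  sumSplits-+ F G (x ∷ xs) = trans (+-congˡ (sumSplits-+ _ _ xs)) (interchange _ _ _ _)

  sumSplits-*ˡ : ∀ {A : Set} a (F : List A → List A → Carrier) m →
                 sumSplits (λ u v → a * F u v) m ≈ a * sumSplits F m
  sumSplits-*ˡ a F []       = refl
  sumSplits-*ˡ a F (x ∷ xs) = trans (+-congˡ (sumSplits-*ˡ a _ xs)) (sym (distribˡ a _ _))

  ⊛-assoc : ∀ {A : Set} (f g h : List A → Carrier) m → ((f ⊛ g) ⊛ h) m ≈ (f ⊛ (g ⊛ h)) m
  ⊛-assoc f g h []       = *-assoc _ _ _
  ⊛-assoc {A} f g h (x ∷ xs) = begin
    (f [] * g []) * h (x ∷ xs) + sumSplits (λ u v → (f ⊛ g) (x ∷ u) * h v) xs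
      ≈⟨ +-congˡ splitsOfTail ⟩
    (f [] * g []) * h (x ∷ xs) + (f [] * (g′ ⊛ h) xs + (f′ ⊛ (g ⊛ h)) xs)
      ≈⟨ +-assoc _ _ _ ⟨
    ((f [] * g []) * h (x ∷ xs) + f [] * (g′ ⊛ h) xs) + (f′ ⊛ (g ⊛ h)) xs
      ≈⟨ +-congʳ (trans (+-congʳ (*-assoc _ _ _)) (sym (distribˡ _ _ _))) ⟩
    f [] * (g [] * h (x ∷ xs) + (g′ ⊛ h) xs) + (f′ ⊛ (g ⊛ h)) xs ∎
    where
    f′ g′ : List A → Carrier
    f′ u = f (x ∷ u)
    g′ u = g (x ∷ u)
    splitsOfTail : sumSplits (λ u v → (f ⊛ g) (x ∷ u) * h v) xs
                   ≈ f [] * (g′ ⊛ h) xs + (f′ ⊛ (g ⊛ h)) xs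
    splitsOfTail = begin
      sumSplits (λ u v → (f [] * g′ u + (f′ ⊛ g) u) * h v) xs
        ≈⟨ sumSplits-cong′ xs (λ u v → distribʳ (h v) _ _) ⟩
      sumSplits (λ u v → f [] * g′ u * h v + (f′ ⊛ g) u * h v) xs
        ≈⟨ sumSplits-+ _ _ xs ⟩
      sumSplits (λ u v → f [] * g′ u * h v) xs + ((f′ ⊛ g) ⊛ h) xs
        ≈⟨ +-cong (trans (sumSplits-cong′ xs (λ u v → *-assoc _ _ _)) (sumSplits-*ˡ (f []) _ xs))
                  (⊛-assoc f′ g h xs) ⟩
      f [] * (g′ ⊛ h) xs + (f′ ⊛ (g ⊛ h)) xs ∎

module _ {c ℓ : Level} (R : CommutativeRing c ℓ) where
  open CommutativeRing R
  open PowerSeries R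
  open Sums +-monoid using (sumSplits-cong; sumSplits-zero)
  open Factorizations +-monoid using (∑-facs-onSuppOK)
  open Convolution semiring using (_⊛_; ⊛-assoc)
  open import Relation.Binary.Reasoning.Setoid setoid

  ⊛-identityˡ : ∀ f m → (one ⊛ f) m ≈ f m
  ⊛-identityˡ f []       = *-identityˡ _
  ⊛-identityˡ f (x ∷ xs) =
    trans (+-cong (*-identityˡ _) (sumSplits-zero xs (λ _ _ → zeroˡ _))) (+-identityʳ _)

  ⊛-identityʳ : ∀ f m → (f ⊛ one) m ≈ f m
  ⊛-identityʳ f []       = *-identityʳ _
  ⊛-identityʳ f (x ∷ xs) =
    trans (+-cong (zeroʳ _) (⊛-identityʳ (λ u → f (x ∷ u)) xs)) (+-identityˡ _)

  ▷≈⊛ : ∀ f g {m} → AllPairs _≤_ m → (f ▷ g) m ≈ (f ⊛ g) m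
  ▷≈⊛ f g {m} m↗ = ∑-facs-onSuppOK (λ p q → f p * g q) (length m) m m↗ ≤-refl

  ▷-assoc : ∀ f g h → ((f ▷ g) ▷ h) ≈ₛ (f ▷ (g ▷ h))
  ▷-assoc f g h m m-sorted = begin
    ((f ▷ g) ▷ h) m  ≈⟨ ▷≈⊛ _ h m↗ ⟩
    ((f ▷ g) ⊛ h) m  ≈⟨ sumSplits-cong m (λ k → *-congʳ (▷≈⊛ f g (AllPairs.take⁺ k m↗))) ⟩
    ((f ⊛ g) ⊛ h) m  ≈⟨ ⊛-assoc f g h m ⟩
    (f ⊛ (g ⊛ h)) m  ≈⟨ sumSplits-cong m (λ k → *-congˡ (▷≈⊛ g h (AllPairs.drop⁺ k m↗))) ⟨
    (f ⊛ (g ▷ h)) m  ≈⟨ ▷≈⊛ f _ m↗ ⟨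
    (f ▷ (g ▷ h)) m  ∎
    where
    m↗ : AllPairs _≤_ m
    m↗ = Sorted⇒AllPairs ≤-totalOrder m-sorted

  ▷-identityˡ : ∀ f → (one ▷ f) ≈ₛ f
  ▷-identityˡ f m m-sorted =
    trans (▷≈⊛ one f (Sorted⇒AllPairs ≤-totalOrder m-sorted)) (⊛-identityˡ f m)

  ▷-identityʳ : ∀ f → (f ▷ one) ≈ₛ f
  ▷-identityʳ f m m-sorted =
    trans (▷≈⊛ f one (Sorted⇒AllPairs ≤-totalOrder m-sorted)) (⊛-identityʳ f m)

proposition3p4 : ∀ {c ℓ : Level} (R : CommutativeRing c ℓ)
    → let open PowerSeries R in
      (∀ f g h → ((f ▷ g) ▷ h) ≈ₛ (f ▷ (g ▷ h)))
      × (∀ f → (one ▷ f) ≈ₛ f)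
      × (∀ f → (f ▷ one) ≈ₛ f)
proposition3p4 R = ▷-assoc R , ▷-identityˡ R , ▷-identityʳ R
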